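{- Let $\Lambda_{\mathrm{Prop}}=(\mathcal{L}_{\mathrm{Prop}},\mathfrak{M}_{\mathrm{Prop}},\models_{\mathrm{Prop}})$ be the satisfaction system of classical propositional logic over a finite set $\mathcal{P}$ of atoms. For $B\in\mathcal{P}_{\mathrm{fin}}(\mathcal{L}_{\mathrm{Prop}})$ and $\mathbb{M}\subseteq\mathfrak{M}_{\mathrm{Prop}}$ define $$\ominus_{\mathrm{Prop}}(B,\mathbb{M})=\Big\{\bigvee_{v\in\mathrm{Mod}(B)\setminus\mathbb{M}}\Big(\bigwedge_{a\in\mathcal{P},\,v(a)=\mathrm{true}}a\wedge\bigwedge_{a\in\mathcal{P},\,v(a)=\mathrm{false}}\neg a\Big)\Big\},$$ $$\oplus_{\mathrm{Prop}}(B,\mathbb{M})=\Big\{\bigvee_{v\in\mathrm{Mod}(B)\cup\mathbb{M}}\Big(\bigwedge_{a\in\mathcal{P},\,v(a)=\mathrm{true}}a\wedge\bigwedge_{a\in\mathcal{P},\,v(a)=\mathrm{false}}\neg a\Big)\Big\}.$$ Then $\ominus_{\mathrm{Prop}}$ is a maxichoice eviction function on $\Lambda_{\mathrm{Prop}}$ and $\oplus_{\mathrm{Prop}}$ is a maxichoice reception function on $\Lambda_{\mathrm{Prop}}$.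
   Context: $\mathcal{L}_{\mathrm{Prop}}$ is the set of classical propositional formulae over the finite atom set $\mathcal{P}$, $\mathfrak{M}_{\mathrm{Prop}}$ the set of Boolean valuations of $\mathcal{P}$, and $v\models_{\mathrm{Prop}}B$ iff $v$ satisfies every formula of $B$. An empty disjunction stands for an unsatisfiable formula (falsum) and an empty conjunction for a tautology, as usual. For a satisfaction system $\Lambda=(\mathcal{L},\mathfrak{M},\models)$: $\mathrm{Mod}(B)=\{m\in\mathfrak{M}\mid m\models B\}$; $\mathcal{P}_{\mathrm{fin}}(\mathcal{L})$ is the set of finite subsets of $\mathcal{L}$; $\mathrm{FR}(\Lambda)=\{\mathrm{Mod}(B)\mid B\in\mathcal{P}_{\mathrm{fin}}(\mathcal{L})\}$; $\mathrm{FRsubs}(\mathbb{M},\Lambda)$ is the set of $\subseteq$-maximal elements of $\{X\in\mathrm{FR}(\Lambda)\mid X\subseteq\mathbb{M}\}$ and $\mathrm{FRsups}(\mathbb{M},\Lambda)$ the set of $\subseteq$-minimal elements of $\{X\in\mathrm{FR}(\Lambda)\mid\mathbb{M}\subseteq X\}$. A selection function on $\Lambda$ is a map $\gamma$ from the nonempty subsets of $\mathrm{FR}(\Lambda)$ to $\mathrm{FR}(\Lambda)$ with $\gamma(X)\in X$. A function $f:\mathcal{P}_{\mathrm{fin}}(\mathcal{L})\times\mathcal{P}(\mathfrak{M})\to\mathcal{P}_{\mathrm{fin}}(\mathcal{L})$ is a maxichoice eviction function if there is a selection function $\gamma$ with $\mathrm{Mod}(f(B,\mathbb{M}))=\gamma(\mathrm{FRsubs}(\mathrm{Mod}(B)\setminus\mathbb{M},\Lambda))$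 for all $B,\mathbb{M}$, and a maxichoice reception function if there is a selection function $\gamma$ with $\mathrm{Mod}(f(B,\mathbb{M}))=\gamma(\mathrm{FRsups}(\mathrm{Mod}(B)\cup\mathbb{M},\Lambda))$ for all $B,\mathbb{M}$. -}

module Defs where

open import Data.Bool using (Bool; true; false; _∧_; _∨_; not; if_then_else_)
open import Data.Nat using (ℕ; zero; suc)
open import Data.Fin using (Fin)
open import Data.Vec using (Vec; []; _∷_; lookup)
open import Data.List using (List; []; _∷_; [_]; map; _++_; foldr; filterᵇ; allFin)
open import Data.Product using (Σ; _×_; ∃)
open import Relation.Binary.PropositionalEquality using (_≡_)

data Form (n : ℕ) : Set where
  atom : Fin n → Form n
  ⊤'   : Form n
  ⊥'   : Form n
  ¬'_  : Form n → Form n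
  _∧'_ : Form n → Form n → Form n
  _∨'_ : Form n → Form n → Form n
  _⇒'_ : Form n → Form n → Form n

Valuation : ℕ → Set
Valuation n = Vec Bool n

eval : ∀ {n} → Valuation n → Form n → Bool
eval v (atom a) = lookup v a
eval v ⊤' = true
eval v ⊥' = false
eval v (¬' φ) = not (eval v φ)
eval v (φ ∧' ψ) = eval v φ ∧ eval v ψ
eval v (φ ∨' ψ) = eval v φ ∨ eval v ψ
eval v (φ ⇒' ψ) = not (eval v φ) ∨ eval v ψ

-- Finite sets of formulae (𝒫_fin(ℒ)) are represented by lists.
-- v ⊨ B iff v satisfies every formula of B.
_⊨_ : ∀ {n} → Valuation n → List (Form n) → Bool
v ⊨ B = foldr (λ φ b → eval v φ ∧ b) true B

MSet : ℕ → Set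
MSet n = Valuation n → Bool

_≐_ : ∀ {n} → MSet n → MSet n → Set
S ≐ T = ∀ v → S v ≡ T v

_⊆_ : ∀ {n} → MSet n → MSet n → Set
S ⊆ T = ∀ v → S v ≡ true → T v ≡ true

_∖_ : ∀ {n} → MSet n → MSet n → MSet n
(S ∖ T) v = S v ∧ not (T v)

_∪_ : ∀ {n} → MSet n → MSet n → MSet n
(S ∪ T) v = S v ∨ T v

Mod : ∀ {n} → List (Form n) → MSet n
Mod B v = v ⊨ B

FR : ∀ {n} → MSet n → Set
FR {n} S = Σ (List (Form n)) λ B → Mod B ≐ S

FRsubs : ∀ {n} → MSet n → MSet n → Set
FRsubs M X = FR X × X ⊆ M × (∀ Y → FR Y → Y ⊆ M → X ⊆ Y → Y ⊆ X)

FRsups : ∀ {n} → MSet n → MSet n → Set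
FRsups M X = FR X × M ⊆ X × (∀ Y → FR Y → M ⊆ Y → Y ⊆ X → X ⊆ Y)

Family : ℕ → Set
Family n = MSet n → Bool

-- A family genuinely represents a set of sets iff it respects set equality.
Respects : ∀ {n} → Family n → Set
Respects X = ∀ S T → S ≐ T → X S ≡ X T

record SelectionFunction (n : ℕ) : Set where
  field
    γ   : Family n → MSet n
    sel : ∀ X → Respects X → (∃ λ S → X S ≡ true)
          → (∀ S → X S ≡ true → FR S) → X (γ X) ≡ true
    ext : ∀ X Y → Respects X → Respects Y → (∀ S → X S ≡ Y S) → γ X ≐ γ Y

Represents : ∀ {n} → Family n → (MSet n → Set) → Set
Represents X P = ∀ S → (X S ≡ true → P S) × (P S → X S ≡ true)

IsMaxichoiceEviction : ∀ {n} → (List (Form n) → MSet n → List (Form n)) → Set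
IsMaxichoiceEviction {n} f =
  Σ (SelectionFunction n) λ sf →
    ∀ B M (X : Family n) → Represents X (FRsubs (Mod B ∖ M)) →
      Mod (f B M) ≐ SelectionFunction.γ sf X

IsMaxichoiceReception : ∀ {n} → (List (Form n) → MSet n → List (Form n)) → Set
IsMaxichoiceReception {n} f =
  Σ (SelectionFunction n) λ sf →
    ∀ B M (X : Family n) → Represents X (FRsups (Mod B ∪ M)) →
      Mod (f B M) ≐ SelectionFunction.γ sf X

allVals : ∀ n → List (Valuation n)
allVals zero = [] ∷ []
allVals (suc n) = map (true ∷_) (allVals n) ++ map (false ∷_) (allVals n)

bigAnd : ∀ {n} → List (Form n) → Form n
bigAnd = foldr _∧'_ ⊤'

bigOr : ∀ {n} → List (Form n) → Form n
bigOr = foldr _∨'_ ⊥'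

minterm : ∀ {n} → Valuation n → Form n
minterm {n} v =
  bigAnd (map atom (filterᵇ (λ a → lookup v a) (allFin n)))
  ∧' bigAnd (map (λ a → ¬' atom a) (filterᵇ (λ a → not (lookup v a)) (allFin n)))

ominusProp : ∀ {n} → List (Form n) → MSet n → List (Form n)
ominusProp {n} B M = [ bigOr (map minterm (filterᵇ (Mod B ∖ M) (allVals n))) ]

oplusProp : ∀ {n} → List (Form n) → MSet n → List (Form n)
oplusProp {n} B M = [ bigOr (map minterm (filterᵇ (Mod B ∪ M) (allVals n))) ]

{-# OPTIONS --safe #-}
-- Over finitely many atoms every set of valuations is the model set of its
-- disjunctive normal form, the disjunction of the minterms of its members.  So
-- every set is finitely representable: the only maximal finitely representable
-- subset of Mod B ∖ M, and the only minimal finitely representable superset of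
-- Mod B ∪ M, is that set itself, and any selection function must pick it; the
-- two operators return exactly its disjunctive normal form.  A selection
-- function exists because every set of valuations is ≐ to one obtained from a
-- sublist of the list of all valuations, so a family can be searched.
module Submission where

open import Defs
open import Data.Bool using (Bool; true; false; not; T; T?)
open import Data.Bool.Properties using (T-≡; T-not-≡; T-∧; T-∨; ⇔→≡; ∧-identityʳ)
open import Data.Empty using (⊥-elim)
open import Data.List using (List; []; _∷_; [_]; map; _++_; filterᵇ; allFin; findᵇ)
open import Data.List.Membership.Propositional using (_∈_)
open import Data.List.Membership.Propositional.Properties
  using (∈-allFin; ∈-map⁺; ∈-++⁺ˡ; ∈-++⁺ʳ; ∈-filter⁺; ∈-filter⁻)
open import Data.List.Relation.Unary.All as All using (All; []; _∷_)
open import Data.List.Relation.Unary.All.Properties as All using (all-filter)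
open import Data.List.Relation.Unary.Any as Any using (Any; here; there)
open import Data.List.Relation.Unary.Any.Properties as Any using ()
open import Data.Maybe using (fromMaybe)
open import Data.Nat using (ℕ; suc)
open import Data.Product using (_×_; _,_; proj₁; proj₂)
open import Data.Sum using (inj₁; inj₂)
open import Data.Vec using (Vec; []; _∷_; lookup)
open import Data.Vec.Properties using (tabulate∘lookup; tabulate-cong)
open import Function using (_∘_; Equivalence; mk⇔)
open import Relation.Binary.PropositionalEquality using (_≡_; _≗_; refl; sym; trans; cong)

private
  variable
    n : ℕ
    A : Set

lookup-≗⇒≡ : (xs ys : Vec A n) → lookup xs ≗ lookup ys → xs ≡ ys
lookup-≗⇒≡ xs ys eq =
  trans (sym (tabulate∘lookup xs)) (trans (tabulate-cong eq) (tabulate∘lookup ys))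

T-⇔⇒≡ : {x y : Bool} → (T x → T y) → (T y → T x) → x ≡ y
T-⇔⇒≡ {true}  {true}  _ _ = refl
T-⇔⇒≡ {true}  {false} f _ = ⊥-elim (f _)
T-⇔⇒≡ {false} {true}  _ g = ⊥-elim (g _)
T-⇔⇒≡ {false} {false} _ _ = refl

T-bigAnd⁺ : {v : Valuation n} (φs : List (Form n)) → All (T ∘ eval v) φs → T (eval v (bigAnd φs))
T-bigAnd⁺ []       []         = _
T-bigAnd⁺ (φ ∷ φs) (px ∷ pxs) = Equivalence.from T-∧ (px , T-bigAnd⁺ φs pxs)

T-bigAnd⁻ : {v : Valuation n} (φs : List (Form n)) → T (eval v (bigAnd φs)) → All (T ∘ eval v) φs
T-bigAnd⁻ []       _ = []
T-bigAnd⁻ (φ ∷ φs) h = let px , pxs = Equivalence.to T-∧ h in px ∷ T-bigAnd⁻ φs pxs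

T-bigOr⁺ : {v : Valuation n} {φs : List (Form n)} → Any (T ∘ eval v) φs → T (eval v (bigOr φs))
T-bigOr⁺ (here px)   = Equivalence.from T-∨ (inj₁ px)
T-bigOr⁺ (there pxs) = Equivalence.from T-∨ (inj₂ (T-bigOr⁺ pxs))

T-bigOr⁻ : {v : Valuation n} (φs : List (Form n)) → T (eval v (bigOr φs)) → Any (T ∘ eval v) φs
T-bigOr⁻ (φ ∷ φs) h with Equivalence.to T-∨ h
... | inj₁ px  = here px
... | inj₂ pxs = there (T-bigOr⁻ φs pxs)

T-minterm-self : (w : Valuation n) → T (eval w (minterm w))
T-minterm-self {n} w = Equivalence.from T-∧
  ( T-bigAnd⁺ _ (All.map⁺ (all-filter (T? ∘ lookup w) (allFin n)))
  , T-bigAnd⁺ _ (All.map⁺ (all-filter (T? ∘ not ∘ lookup w) (allFin n))) )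

T-minterm⇒≡ : (v w : Valuation n) → T (eval v (minterm w)) → v ≡ w
T-minterm⇒≡ {n} v w h = lookup-≗⇒≡ v w agree
  where
  positive : All (T ∘ eval v ∘ atom) (filterᵇ (lookup w) (allFin n))
  positive = All.map⁻ (T-bigAnd⁻ _ (proj₁ (Equivalence.to T-∧ h)))

  negative : All (T ∘ eval v ∘ ¬'_ ∘ atom) (filterᵇ (not ∘ lookup w) (allFin n))
  negative = All.map⁻ (T-bigAnd⁻ _ (proj₂ (Equivalence.to T-∧ h)))

  agree : lookup v ≗ lookup w
  agree a with lookup w a in eq
  ... | true  = Equivalence.to T-≡
    (All.lookup positive (∈-filter⁺ (T? ∘ lookup w) (∈-allFin a) (Equivalence.from T-≡ eq)))
  ... | false = Equivalence.to T-not-≡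
    (All.lookup negative (∈-filter⁺ (T? ∘ not ∘ lookup w) (∈-allFin a) (Equivalence.from T-not-≡ eq)))

∈⇒T-bigOr-minterms : {v : Valuation n} {ws : List (Valuation n)} →
                     v ∈ ws → T (eval v (bigOr (map minterm ws)))
∈⇒T-bigOr-minterms {v = v} v∈ws =
  T-bigOr⁺ (Any.map⁺ {f = minterm} (Any.map (λ { refl → T-minterm-self v }) v∈ws))

T-bigOr-minterms⇒∈ : {v : Valuation n} (ws : List (Valuation n)) →
                     T (eval v (bigOr (map minterm ws))) → v ∈ ws
T-bigOr-minterms⇒∈ {v = v} ws h = Any.map (T-minterm⇒≡ v _) (Any.map⁻ (T-bigOr⁻ _ h))

∈-allVals : (v : Valuation n) → v ∈ allVals n
∈-allVals []                  = here refl
∈-allVals {suc n} (true ∷ v)  = ∈-++⁺ˡ (∈-map⁺ (true ∷_) (∈-allVals v))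
∈-allVals {suc n} (false ∷ v) = ∈-++⁺ʳ (map (true ∷_) (allVals n)) (∈-map⁺ (false ∷_) (∈-allVals v))

dnf : MSet n → Form n
dnf {n} S = bigOr (map minterm (filterᵇ S (allVals n)))

eval-dnf : (S : MSet n) (v : Valuation n) → eval v (dnf S) ≡ S v
eval-dnf {n} S v = T-⇔⇒≡
  (proj₂ ∘ ∈-filter⁻ (T? ∘ S) {xs = allVals n} ∘ T-bigOr-minterms⇒∈ (filterᵇ S (allVals n)))
  (∈⇒T-bigOr-minterms ∘ ∈-filter⁺ (T? ∘ S) (∈-allVals v))

Mod-dnf : (S : MSet n) → Mod [ dnf S ] ≐ S
Mod-dnf S v = trans (∧-identityʳ _) (eval-dnf S v)

FR-every : (S : MSet n) → FR S
FR-every S = [ dnf S ] , Mod-dnf S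

≐-sym : {S T : MSet n} → S ≐ T → T ≐ S
≐-sym S≐T v = sym (S≐T v)

≐-trans : {S T U : MSet n} → S ≐ T → T ≐ U → S ≐ U
≐-trans S≐T T≐U v = trans (S≐T v) (T≐U v)

⊆-refl : {S : MSet n} → S ⊆ S
⊆-refl _ Sv = Sv

⊆-antisym : {S T : MSet n} → S ⊆ T → T ⊆ S → S ≐ T
⊆-antisym S⊆T T⊆S v = ⇔→≡ (mk⇔ (S⊆T v) (T⊆S v))

⊆-respˡ-≐ : {S T U : MSet n} → S ≐ T → S ⊆ U → T ⊆ U
⊆-respˡ-≐ S≐T S⊆U v Tv = S⊆U v (trans (S≐T v) Tv)

⊆-respʳ-≐ : {S T U : MSet n} → S ≐ T → U ⊆ S → U ⊆ T
⊆-respʳ-≐ S≐T U⊆S v Uv = trans (sym (S≐T v)) (U⊆S v Uv)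

FR-resp-≐ : {S T : MSet n} → S ≐ T → FR S → FR T
FR-resp-≐ S≐T (B , ModB≐S) = B , ≐-trans ModB≐S S≐T

FRsubs-resp-≐ : {M S T : MSet n} → S ≐ T → FRsubs M S → FRsubs M T
FRsubs-resp-≐ S≐T (frS , S⊆M , maximal) =
  FR-resp-≐ S≐T frS , ⊆-respˡ-≐ S≐T S⊆M ,
  λ Y frY Y⊆M T⊆Y → ⊆-respʳ-≐ S≐T (maximal Y frY Y⊆M (⊆-respˡ-≐ (≐-sym S≐T) T⊆Y))

FRsups-resp-≐ : {M S T : MSet n} → S ≐ T → FRsups M S → FRsups M T
FRsups-resp-≐ S≐T (frS , M⊆S , minimal) =
  FR-resp-≐ S≐T frS , ⊆-respʳ-≐ S≐T M⊆S ,
  λ Y frY M⊆Y Y⊆T → ⊆-respˡ-≐ S≐T (minimal Y frY M⊆Y (⊆-respʳ-≐ (≐-sym S≐T) Y⊆T))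

FRsubs-self : {M : MSet n} → FR M → FRsubs M M
FRsubs-self frM = frM , ⊆-refl , λ _ _ Y⊆M _ → Y⊆M

FRsubs⇒≐ : {M X : MSet n} → FR M → FRsubs M X → X ≐ M
FRsubs⇒≐ frM (_ , X⊆M , maximal) = ⊆-antisym X⊆M (maximal _ frM ⊆-refl X⊆M)

FRsups-self : {M : MSet n} → FR M → FRsups M M
FRsups-self frM = frM , ⊆-refl , λ _ _ M⊆Y _ → M⊆Y

FRsups⇒≐ : {M X : MSet n} → FR M → FRsups M X → X ≐ M
FRsups⇒≐ frM (_ , M⊆X , minimal) = ⊆-antisym (minimal _ frM ⊆-refl M⊆X) M⊆X

Represents-respects : {X : Family n} {P : MSet n → Set} → Represents X P →
                      (∀ {S T} → S ≐ T → P S → P T) → Respects X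
Represents-respects rep P-resp S T S≐T = ⇔→≡ (mk⇔
  (λ XS → proj₂ (rep T) (P-resp S≐T (proj₁ (rep S) XS)))
  (λ XT → proj₂ (rep S) (P-resp (≐-sym S≐T) (proj₁ (rep T) XT))))

γ-singleton : (sf : SelectionFunction n) {X : Family n} {P : MSet n → Set} {M : MSet n} →
              Represents X P → (∀ {S T} → S ≐ T → P S → P T) → (∀ {S} → P S → FR S) →
              P M → (∀ {S} → P S → S ≐ M) → SelectionFunction.γ sf X ≐ M
γ-singleton sf {X} {M = M} rep P-resp P⇒FR PM P⇒≐M =
  P⇒≐M (proj₁ (rep (γ X)) (sel X (Represents-respects rep P-resp) (M , proj₂ (rep M) PM)
                                  (λ S → P⇒FR ∘ proj₁ (rep S))))
  where open SelectionFunction sf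

sublists : List A → List (List A)
sublists []       = [ [] ]
sublists (x ∷ xs) = map (x ∷_) (sublists xs) ++ sublists xs

filterᵇ-∈-sublists : (p : A → Bool) (xs : List A) → filterᵇ p xs ∈ sublists xs
filterᵇ-∈-sublists p []       = here refl
filterᵇ-∈-sublists p (x ∷ xs) with p x
... | true  = ∈-++⁺ˡ (∈-map⁺ (x ∷_) (filterᵇ-∈-sublists p xs))
... | false = ∈-++⁺ʳ (map (x ∷_) (sublists xs)) (filterᵇ-∈-sublists p xs)

findᵇ-cong : {p q : A → Bool} (xs : List A) → p ≗ q → findᵇ p xs ≡ findᵇ q xs
findᵇ-cong                 []       _   = refl
findᵇ-cong {p = p} {q = q} (x ∷ xs) p≗q with p x | q x | p≗q x
... | true  | true  | refl = refl
... | false | false | refl = findᵇ-cong xs p≗q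

findᵇ-satisfies : {p : A → Bool} {x : A} (d : A) (xs : List A) →
                  x ∈ xs → p x ≡ true → p (fromMaybe d (findᵇ p xs)) ≡ true
findᵇ-satisfies {p = p} d (y ∷ xs) x∈xs px with p y in py
findᵇ-satisfies d (y ∷ xs) x∈xs         px | true  = py
findᵇ-satisfies d (y ∷ xs) (here refl)  px | false with () ← trans (sym px) py
findᵇ-satisfies d (y ∷ xs) (there x∈xs) px | false = findᵇ-satisfies d xs x∈xs px

selectionFunction : (n : ℕ) → SelectionFunction n
selectionFunction n = record
  { γ   = choose
  ; sel = λ X X-resp (S , XS) _ → findᵇ-satisfies {p = X} ∅ candidates
            (∈-map⁺ modelsOfMinterms (filterᵇ-∈-sublists S (allVals n)))
            (trans (X-resp _ S (Mod-dnf S)) XS)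
  ; ext = λ X Y _ _ X≗Y v → cong (λ found → fromMaybe ∅ found v) (findᵇ-cong candidates X≗Y)
  }
  where
  ∅ : MSet n
  ∅ _ = false

  modelsOfMinterms : List (Valuation n) → MSet n
  modelsOfMinterms ws = Mod [ bigOr (map minterm ws) ]

  candidates : List (MSet n)
  candidates = map modelsOfMinterms (sublists (allVals n))

  choose : Family n → MSet n
  choose X = fromMaybe ∅ (findᵇ X candidates)

proposition6 : (n : ℕ) → IsMaxichoiceEviction (ominusProp {n}) × IsMaxichoiceReception (oplusProp {n})
proposition6 n = (sf , eviction) , (sf , reception)
  where
  sf : SelectionFunction n
  sf = selectionFunction n
  open SelectionFunction sf using (γ)

  eviction : ∀ B M (X : Family n) → Represents X (FRsubs (Mod B ∖ M)) → Mod (ominusProp B M) ≐ γ X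
  eviction B M X rep = ≐-trans (Mod-dnf (Mod B ∖ M)) (≐-sym
    (γ-singleton sf rep FRsubs-resp-≐ proj₁ (FRsubs-self (FR-every _)) (FRsubs⇒≐ (FR-every _))))

  reception : ∀ B M (X : Family n) → Represents X (FRsups (Mod B ∪ M)) → Mod (oplusProp B M) ≐ γ X
  reception B M X rep = ≐-trans (Mod-dnf (Mod B ∪ M)) (≐-sym
    (γ-singleton sf rep FRsups-resp-≐ proj₁ (FRsups-self (FR-every _)) (FRsups⇒≐ (FR-every _))))
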